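{- Let $\mathbf{Q}$ be a QB-algebra and $x$ a regular element of $\mathbf{Q}$. Then the map $f:cl(x)\to cl(x^{*})$, $f(y)=y^{*}$, is a bijection.
   Context: A quasi-lattice is an algebra $\langle L;\vee,\wedge\rangle$ such that for all $x,y,z$: $\vee,\wedge$ are commutative and associative; $x\vee(x\wedge y)=x\vee x$ and $x\wedge(x\vee y)=x\wedge x$; $x\vee(y\vee y)=x\vee y$ and $x\wedge(y\wedge y)=x\wedge y$; $x\vee x=x\wedge x$; distributive if both distributive laws hold. A QB-algebra is an algebra $\langle Q;\vee,\wedge,{}^{*},0,1\rangle$ of type $\langle 2,2,1,0,0\rangle$ such that $\langle Q;\vee,\wedge\rangle$ is a distributive quasi-lattice and for all $x$: $x\vee 1=1$, $x\wedge 0=0$, $x\vee x^{*}=1$, $x\wedge x^{*}=0$, $(x\wedge x)^{*}=x^{*}\vee x^{*}$, $x^{**}=x$. An element $x$ is regular if $x\vee x=x$. For a regular element $x$, $cl(x)=\{y\in Q: y\vee y=x\vee x\}$ (the cloud of $x$). -}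

module Defs where

open import Level using (Level; suc; _⊔_)
open import Data.Product using (Σ; _,_; proj₁; proj₂; _×_)
open import Relation.Binary.PropositionalEquality using (_≡_)
open import Function.Definitions using (Bijective)

record QBAlgebra (ℓ : Level) : Set (suc ℓ) where
  infixr 6 _∨_
  infixr 7 _∧_
  field
    Q     : Set ℓ
    _∨_   : Q → Q → Q
    _∧_   : Q → Q → Q
    _*    : Q → Q
    𝟎     : Q
    𝟏     : Q
    ∨-comm    : ∀ x y → x ∨ y ≡ y ∨ x
    ∧-comm    : ∀ x y → x ∧ y ≡ y ∧ x
    ∨-assoc   : ∀ x y z → (x ∨ y) ∨ z ≡ x ∨ (y ∨ z)
    ∧-assoc   : ∀ x y z → (x ∧ y) ∧ z ≡ x ∧ (y ∧ z)
    ∨-absorb  : ∀ x y → x ∨ (x ∧ y) ≡ x ∨ x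
    ∧-absorb  : ∀ x y → x ∧ (x ∨ y) ≡ x ∧ x
    ∨-idem-r  : ∀ x y → x ∨ (y ∨ y) ≡ x ∨ y
    ∧-idem-r  : ∀ x y → x ∧ (y ∧ y) ≡ x ∧ y
    ∨∧-same   : ∀ x → x ∨ x ≡ x ∧ x
    ∧-distrib-∨ : ∀ x y z → x ∧ (y ∨ z) ≡ (x ∧ y) ∨ (x ∧ z)
    ∨-distrib-∧ : ∀ x y z → x ∨ (y ∧ z) ≡ (x ∨ y) ∧ (x ∨ z)
    ∨-top     : ∀ x → x ∨ 𝟏 ≡ 𝟏
    ∧-bot     : ∀ x → x ∧ 𝟎 ≡ 𝟎
    ∨-compl   : ∀ x → x ∨ (x *) ≡ 𝟏
    ∧-compl   : ∀ x → x ∧ (x *) ≡ 𝟎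
    *-∧∧      : ∀ x → (x ∧ x) * ≡ (x *) ∨ (x *)
    *-invol   : ∀ x → (x *) * ≡ x

  Regular : Q → Set ℓ
  Regular x = x ∨ x ≡ x

  _∈cl_ : Q → Q → Set ℓ
  y ∈cl x = y ∨ y ≡ x ∨ x

  Cl : Q → Set ℓ
  Cl x = Σ Q (λ y → y ∈cl x)

  _≈cl_ : ∀ {x} → Cl x → Cl x → Set ℓ
  a ≈cl b = proj₁ a ≡ proj₁ b

CloudStarBijection : ∀ {ℓ} (A : QBAlgebra ℓ) → QBAlgebra.Q A → Set ℓ
CloudStarBijection A x =
  Σ (∀ y → y ∈cl x → (y *) ∈cl (x *)) λ into →
    Bijective (_≈cl_ {x}) (_≈cl_ {x *}) (λ (p : Cl x) → (proj₁ p *) , into (proj₁ p) (proj₂ p))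
  where open QBAlgebra A

module Submission where

open import Defs
open import Data.Product using (Σ; _,_; proj₁)
open import Relation.Binary.PropositionalEquality

-- The star is an involution, hence a bijection of Q; it respects clouds because
-- y ∨ y = y ∧ y and (y ∧ y)* = y* ∨ y*, so the cloud of y* is determined by that of y.

module _ {ℓ} (A : QBAlgebra ℓ) where
  open QBAlgebra A

  *-injective : ∀ {y z} → y * ≡ z * → y ≡ z
  *-injective {y} {z} eq = begin
    y        ≡⟨ sym (*-invol y) ⟩
    (y *) *  ≡⟨ cong _* eq ⟩
    (z *) *  ≡⟨ *-invol z ⟩
    z        ∎
    where open ≡-Reasoning

  *-∨∨ : ∀ y → (y ∨ y) * ≡ (y *) ∨ (y *)
  *-∨∨ y = trans (cong _* (∨∧-same y)) (*-∧∧ y)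

  *-∈cl : ∀ {y w} → y ∈cl w → (y *) ∈cl (w *)
  *-∈cl {y} {w} y∈w = begin
    (y *) ∨ (y *)  ≡⟨ sym (*-∨∨ y) ⟩
    (y ∨ y) *      ≡⟨ cong _* y∈w ⟩
    (w ∨ w) *      ≡⟨ *-∨∨ w ⟩
    (w *) ∨ (w *)  ∎
    where open ≡-Reasoning

  *-∈cl⁻ : ∀ {y w} → y ∈cl (w *) → (y *) ∈cl w
  *-∈cl⁻ {y} {w} y∈w* = subst ((y *) ∈cl_) (*-invol w) (*-∈cl y∈w*)

lemma3p5 : ∀ {ℓ} (A : QBAlgebra ℓ) (x : QBAlgebra.Q A) → QBAlgebra.Regular A x → CloudStarBijection A x
lemma3p5 A x _ = (λ _ → *-∈cl A) , (λ {a} {b} → *-injective A {proj₁ a} {proj₁ b}) , preimage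
  where
  open QBAlgebra A
  preimage : ∀ (c : Cl (x *)) → Σ (Cl x) λ p → ∀ {z : Cl x} → proj₁ z ≡ proj₁ p → proj₁ z * ≡ proj₁ c
  preimage (y , y∈x*) = (y * , *-∈cl⁻ A y∈x*) , λ z≡y* → trans (cong _* z≡y*) (*-invol y)
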